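{- Let $\ell \geq 4$ be an even integer and $t \geq 1$ an integer. Let $\gamma$ be the unique integer such that \[ 2\ell + 2 \;\geq\; \ell + 3 - 4(t+2) + \gamma(2\ell+2) \;\geq\; 1, \] let $j = 2\gamma + 1$, and let $r = \ell + 3 - 4(t+2) + \gamma(2\ell+2)$. If $k$ is any integer with $k \geq 4t + 2\ell + 2|\gamma| + 2$, then there is a symmetric complete $(\ell,1)$-sum-free set $S \subseteq \mathbb{Z}_{(2\ell+2)k + r}$.
   Context: For a subset $S$ of an abelian group $\Gamma$ (written additively) and a positive integer $\ell$, the $\ell$-fold sumset is $\ell S = \{ s_1 + s_2 + \dots + s_\ell : s_i \in S\}$. The set $S$ is $(\ell,1)$-sum-free if $(\ell S) \cap S = \emptyset$; such a set is complete if moreover $\ell S \cup S = \Gamma$ (so $\ell S$ and $S$ partition $\Gamma$). $S$ is symmetric if $s \in S$ implies $-s \in S$. $\mathbb{Z}_n$ denotes the cyclic group of integers modulo $n$. -}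

module Defs where

open import Data.Nat using (ℕ; _+_; _*_)
open import Data.Fin using (Fin; toℕ)
open import Data.Fin.Subset using (Subset; _∈_; _∉_)
open import Data.Vec using (Vec)
open import Data.Vec.Relation.Unary.All using (All)
import Data.Vec as Vec
open import Data.Product using (∃; ∃-syntax; Σ-syntax; _×_)
open import Data.Sum using (_⊎_)
open import Relation.Binary.PropositionalEquality using (_≡_)

-- ℤ_n is modelled by Fin n (residues 0 … n-1), addition taken modulo n.
-- ModEq n a b  for naturals a, b with b < n:  a = b + q n  for some q ≥ 0.
ModEq : ℕ → ℕ → ℕ → Set
ModEq n a b = ∃[ q ] (a ≡ b + q * n)

InSumset : ∀ {n} → ℕ → Subset n → Fin n → Set
InSumset {n} ℓ S x =
  Σ[ v ∈ Vec (Fin n) ℓ ] (All (_∈ S) v × ModEq n (Vec.sum (Vec.map toℕ v)) (toℕ x))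

Symmetric : ∀ {n} → Subset n → Set
Symmetric {n} S = ∀ (x : Fin n) → x ∈ S →
  Σ[ y ∈ Fin n ] (y ∈ S × ModEq n (toℕ x + toℕ y) 0)

SumFree : ∀ {n} → ℕ → Subset n → Set
SumFree {n} ℓ S = ∀ (x : Fin n) → InSumset ℓ S x → x ∉ S

CompleteSumFree : ∀ {n} → ℕ → Subset n → Set
CompleteSumFree {n} ℓ S = SumFree ℓ S × (∀ (x : Fin n) → x ∈ S ⊎ InSumset ℓ S x)

-- Write ℓ = 2p, D = 2t + 5, w = k + γ - t - 2, q = ⌊p/2⌋, A = 1 + qD + pw, B = A + w and C = A + B.
-- Then n = 2C - d, where d = D for even p and d = -D for odd p.  Take S = [A, B] ∪ -[A, B] in ℤ_n.
-- A sum of i elements of [A, B] and j elements of -[A, B], i + j = ℓ, ranges over the whole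
-- interval [iA - jB, iB - jA] = [sC - pw, sC + pw], where s = i - p.  Since 2C ≡ d (mod n), the
-- centre sC is ≡ (s/2)d for even s and ≡ C + ((s-1)/2)d for odd s; as |s| ≤ p these intervals
-- stay inside the two gaps (-A, A) and (B, n - B) of S, and since D ≤ 2pw + 1 consecutive ones
-- overlap and together fill both gaps.  Hence ℓS is exactly the complement of S.

module Submission where

open import Data.Nat using (ℕ)
open import Data.Integer using (ℤ)

module IntegerIntervals where

  open import Data.Nat as ℕ using (zero; suc)
  import Data.Nat.Properties as ℕ
  open import Data.Integer using (ℤ; +_; -[1+_]; +≤+; 0ℤ; 1ℤ; _+_; _-_; _*_; -_; _≤_; _⊔_; ∣_∣)
  import Data.Integer.Properties as ℤ
  open import Data.Integer.DivMod using (_%ℕ_; _/ℕ_; n%ℕd<d; a≡a%ℕn+[a/ℕn]*n)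
  open import Data.Integer.Tactic.RingSolver using (solve; solve-∀)
  open import Data.List using (_∷_; [])
  open import Data.Product using (∃-syntax; _×_; _,_)
  open import Data.Sum using (_⊎_; inj₁; inj₂)
  open import Data.Empty using (⊥; ⊥-elim)
  open import Relation.Nullary using (¬_; yes; no)
  open import Relation.Binary.PropositionalEquality using (_≡_; refl; sym; trans; cong; subst)
  open import Defs using (ModEq)

  infix 4 _≤_≤_
  _≤_≤_ : ℤ → ℤ → ℤ → Set
  a ≤ x ≤ b = (a ≤ x) × (x ≤ b)

  0≤+ : ∀ n → 0ℤ ≤ + n
  0≤+ n = +≤+ ℕ.z≤n

  0≤+0≤ : ∀ {x y} → 0ℤ ≤ x → 0ℤ ≤ y → 0ℤ ≤ x + y
  0≤+0≤ = ℤ.+-mono-≤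

  0≤*0≤ : ∀ {x y} → 0ℤ ≤ x → 0ℤ ≤ y → 0ℤ ≤ x * y
  0≤*0≤ {+ a} {+ b} _ _ = subst (0ℤ ≤_) (ℤ.pos-* a b) (0≤+ (a ℕ.* b))

  0≤- : ∀ {x y} → x ≤ y → 0ℤ ≤ y - x
  0≤- = ℤ.i≤j⇒0≤j-i

  -- An inequality x ≤ y is certified by a ring identity writing y - x as a manifestly nonnegative term.
  ≤-by : ∀ {x y e} → 0ℤ ≤ e → y - x ≡ e → x ≤ y
  ≤-by 0≤e refl = ℤ.0≤i-j⇒j≤i 0≤e

  ≤-via : ∀ {x y x′ y′} → x′ ≤ y′ → y - x ≡ y′ - x′ → x ≤ y
  ≤-via h = ≤-by (0≤- h)

  ≰⇒suc≤ : ∀ {x y} → ¬ x ≤ y → 1ℤ + y ≤ x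
  ≰⇒suc≤ h = ℤ.i<j⇒suc[i]≤j (ℤ.≰⇒> h)

  0≤-1-elim : ∀ {e} → 0ℤ ≤ e → e ≡ - 1ℤ → ⊥
  0≤-1-elim () refl

  ≤≤-+ : ∀ {a b c d x y} → a ≤ x ≤ b → c ≤ y ≤ d → a + c ≤ x + y ≤ b + d
  ≤≤-+ (a≤x , x≤b) (c≤y , y≤d) = ℤ.+-mono-≤ a≤x c≤y , ℤ.+-mono-≤ x≤b y≤d

  ≤≤-cast : ∀ {a b x a′ b′ x′} → a ≡ a′ → x ≡ x′ → b ≡ b′ → a ≤ x ≤ b → a′ ≤ x′ ≤ b′
  ≤≤-cast refl refl refl h = h

  ≤≤-split : ∀ {a b c d t} → a ≤ b → c ≤ d → a + c ≤ t ≤ b + d →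
             ∃[ x ] ((a ≤ x ≤ b) × (c ≤ t - x ≤ d))
  ≤≤-split {a} {b} {c} {d} {t} a≤b c≤d (a+c≤t , t≤b+d) =
    x , (ℤ.i≤i⊔j a (t - d) , ℤ.⊔-lub a≤b t-d≤b) , complement (ℤ.i≤j⊔i a (t - d)) x≤t-c
    where
    complement : ∀ {y} → t - d ≤ y → y ≤ t - c → c ≤ t - y ≤ d
    complement {y} t-d≤y y≤t-c =
      ≤-via y≤t-c (solve (t ∷ y ∷ c ∷ [])) , ≤-via t-d≤y (solve (t ∷ y ∷ d ∷ []))
    x : ℤ
    x = a ⊔ (t - d)
    t-d≤b : t - d ≤ b
    t-d≤b = ≤-via t≤b+d (solve (t ∷ b ∷ d ∷ []))
    x≤t-c : x ≤ t - c
    x≤t-c = ℤ.⊔-lub a≤t-c t-d≤t-c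
      where
      a≤t-c : a ≤ t - c
      a≤t-c = ≤-via a+c≤t (solve (a ∷ c ∷ t ∷ []))
      t-d≤t-c : t - d ≤ t - c
      t-d≤t-c = ≤-via c≤d (solve (t ∷ c ∷ d ∷ []))

  window-unique : ∀ {L U y N} K → 0ℤ ≤ N → U + 1ℤ ≤ L + N →
                  L ≤ y ≤ U → L ≤ y + K * N ≤ U → y + K * N ≡ y
  window-unique {L} {U} {y} {N} (+ 0) _ _ _ _ = solve (y ∷ N ∷ [])
  window-unique {L} {U} {y} {N} (+ suc k) 0≤N short (L≤y , _) (_ , up) = ⊥-elim
    (0≤-1-elim (0≤+0≤ (0≤+0≤ (0≤- short) (0≤- L≤y)) (0≤+0≤ (0≤- up) (0≤*0≤ (0≤+ k) 0≤N)))
               (identity L U y (+ k) N))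
    where
    identity : ∀ L U y k N →
      (L + N - (U + 1ℤ)) + (y - L) + ((U - (y + (1ℤ + k) * N)) + k * N) ≡ - 1ℤ
    identity = solve-∀
  window-unique {L} {U} {y} {N} -[1+ k ] 0≤N short (_ , y≤U) (low , _) = ⊥-elim
    (0≤-1-elim (0≤+0≤ (0≤+0≤ (0≤- short) (0≤- y≤U)) (0≤+0≤ (0≤- low) (0≤*0≤ (0≤+ k) 0≤N)))
               (identity L U y (+ k) N))
    where
    identity : ∀ L U y k N →
      (L + N - (U + 1ℤ)) + (U - y) + ((y + (- (1ℤ + k)) * N - L) + k * N) ≡ - 1ℤ
    identity = solve-∀

  record Near (R c y : ℤ) : Set where
    constructor within
    field
      lower : c - R ≤ y
      upper : y ≤ c + R

  -- Consecutive intervals [v D - R , v D + R] overlap because D ≤ 2R + 1.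
  cover : ∀ {D R} → D ≤ + 2 * R + 1ℤ → ∀ {a b y} → a ≤ b → a * D - R ≤ y ≤ b * D + R →
          ∃[ v ] ((a ≤ v ≤ b) × Near R (v * D) y)
  cover {D} {R} D≤2R+1 {a} {b} {y} a≤b =
    go ∣ b - a ∣ (trans (cong (λ c → a + c) (ℤ.0≤i⇒+∣i∣≡i (0≤- a≤b))) (solve (a ∷ b ∷ [])))
    where
    go : ∀ c {b} → a + + c ≡ b → a * D - R ≤ y ≤ b * D + R →
         ∃[ v ] ((a ≤ v ≤ b) × Near R (v * D) y)
    go zero refl (lo , hi) = a , (ℤ.≤-refl , ℤ.≤-reflexive (solve (a ∷ []))) , within lo (≤-via hi (solve (a ∷ D ∷ R ∷ y ∷ [])))
    go (suc c) refl (lo , hi) with y ℤ.≤? (a + + c) * D + R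
    ... | yes y≤ with go c refl (lo , y≤)
    ...   | v , (a≤v , v≤) , near = v , (a≤v , ℤ.≤-trans v≤ (ℤ.+-monoʳ-≤ a (+≤+ (ℕ.n≤1+n c)))) , near
    go (suc c) refl (lo , hi) | no y≰ =
      a + + suc c , (≤-by (0≤+ (suc c)) (cancel a (+ suc c)) , ℤ.≤-refl) ,
      within (≤-by (0≤+0≤ (0≤- (≰⇒suc≤ y≰)) (0≤- D≤2R+1)) (no-gap a (+ c) D R y)) hi
      where
      cancel : ∀ a c → a + c - a ≡ c
      cancel = solve-∀
      no-gap : ∀ a c D R y →
        y - ((a + (1ℤ + c)) * D - R) ≡ (y - (1ℤ + ((a + c) * D + R))) + ((+ 2 * R + 1ℤ) - D)
      no-gap = solve-∀

  even-or-odd : ∀ s → ∃[ v ] (s ≡ v + v ⊎ s ≡ 1ℤ + (v + v))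
  even-or-odd s with s %ℕ 2 | n%ℕd<d s 2 | a≡a%ℕn+[a/ℕn]*n s 2
  ... | 0 | _ | s≡ = s /ℕ 2 , inj₁ (trans s≡ (identity (s /ℕ 2)))
    where identity : ∀ v → + 0 + v * + 2 ≡ v + v
          identity = solve-∀
  ... | 1 | _ | s≡ = s /ℕ 2 , inj₂ (trans s≡ (identity (s /ℕ 2)))
    where identity : ∀ v → + 1 + v * + 2 ≡ 1ℤ + (v + v)
          identity = solve-∀
  ... | suc (suc _) | ℕ.s≤s (ℕ.s≤s ()) | _

  halve-≤ : ∀ {a b} → + 2 * a ≤ + 2 * b + 1ℤ → a ≤ b
  halve-≤ {a} {b} 2a≤2b+1 with a ℤ.≤? b
  ... | yes a≤b = a≤b
  ... | no a≰b = ⊥-elim (0≤-1-elim (0≤+0≤ (0≤- 2a≤2b+1) (0≤*0≤ (0≤+ 2) (0≤- (≰⇒suc≤ a≰b))))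
                                   (identity a b))
    where identity : ∀ a b → (+ 2 * b + 1ℤ - + 2 * a) + + 2 * (a - (1ℤ + b)) ≡ - 1ℤ
          identity = solve-∀

  ModEq⇒ℤ : ∀ {s z q n} j → s ≡ z ℕ.+ q ℕ.* n → + s - + j * + n ≡ + z + (+ q - + j) * + n
  ModEq⇒ℤ {z = z} {q} {n} j refl =
    trans (cong (λ m → + z + m - + j * + n) (ℤ.pos-* q n)) (identity (+ z) (+ q) (+ j) (+ n))
    where identity : ∀ z q j n → z + q * n - j * n ≡ z + (q - j) * n
          identity = solve-∀

  ℤ⇒ModEq : ∀ {a b n} Q → b ℕ.< n → + a ≡ + b + Q * + n → ModEq n a b
  ℤ⇒ModEq {a} {b} {n} (+ q) _ a≡ =
    q , ℤ.+-injective (trans a≡ (trans (cong (λ m → + b + m) (sym (ℤ.pos-* q n))) (sym (ℤ.pos-+ b (q ℕ.* n)))))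
  ℤ⇒ModEq {a} {b} {n} -[1+ k ] b<n a≡ = ⊥-elim
    (0≤-1-elim (0≤+0≤ (0≤+0≤ (0≤+ a) (0≤- (+≤+ b<n))) (0≤*0≤ (0≤+ k) (0≤+ n)))
               (trans (cong (λ m → m + (+ n - (1ℤ + + b)) + + k * + n) a≡) (identity (+ b) (+ k) (+ n))))
    where identity : ∀ b k n → b + (- (1ℤ + k)) * n + (n - (1ℤ + b)) + k * n ≡ - 1ℤ
          identity = solve-∀

  separated : ∀ {a b z} → z ≤ b → 1ℤ + b ≤ a → a ≤ z → ⊥
  separated {a} {b} {z} z≤b b<a a≤z =
    0≤-1-elim (0≤+0≤ (0≤+0≤ (0≤- z≤b) (0≤- b<a)) (0≤- a≤z)) (identity a b z)
    where identity : ∀ a b z → (b - z) + (a - (1ℤ + b)) + (z - a) ≡ - 1ℤ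
          identity = solve-∀

  ≤≤-*-nonNeg : ∀ {a b v D} → 0ℤ ≤ D → a ≤ v ≤ b → a * D ≤ v * D ≤ b * D
  ≤≤-*-nonNeg {a} {b} {v} {D} 0≤D (a≤v , v≤b) =
    ≤-by (0≤*0≤ (0≤- a≤v) 0≤D) (identity a v D) , ≤-by (0≤*0≤ (0≤- v≤b) 0≤D) (identity v b D)
    where identity : ∀ a v D → v * D - a * D ≡ (v - a) * D
          identity = solve-∀

  ≤≤-neg : ∀ {a b v} → a ≤ v ≤ b → - b ≤ - v ≤ - a
  ≤≤-neg (a≤v , v≤b) = ℤ.neg-mono-≤ v≤b , ℤ.neg-mono-≤ a≤v

  recentre : ∀ {R c c′ y} K N → c′ ≡ c + K * N → Near R c y → Near R c′ (y + K * N)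
  recentre {R} {c} {y = y} K N refl (within lo hi) = within (≤-via lo (identity c K N R y)) (≤-via hi (identity′ c K N R y))
    where identity : ∀ c K N R y → y + K * N - (c + K * N - R) ≡ y - (c - R)
          identity = solve-∀
          identity′ : ∀ c K N R y → c + K * N + R - (y + K * N) ≡ c + R - y
          identity′ = solve-∀

  uncentre : ∀ {R c c′ y} K N → c′ ≡ c + K * N → Near R c′ y → Near R c (y + (- K) * N)
  uncentre {c = c} K N refl = recentre (- K) N (identity c K N)
    where identity : ∀ c K N → c ≡ c + K * N + (- K) * N
          identity = solve-∀

  Near-shift : ∀ {R c y} e → Near R c (y - e) → Near R (e + c) y
  Near-shift {R} {c} {y} e (within lo hi) = within (≤-via lo (identity₁ R c e y)) (≤-via hi (identity₂ R c e y))
    where identity₁ : ∀ R c e y → y - (e + c - R) ≡ y - e - (c - R)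
          identity₁ = solve-∀
          identity₂ : ∀ R c e y → e + c + R - y ≡ c + R - (y - e)
          identity₂ = solve-∀

module IntervalSubset (n : ℕ) (A : ℤ) (w : ℕ) where

  open IntegerIntervals
  open import Defs
  open import Data.Nat as ℕ using (ℕ; zero; suc)
  import Data.Nat.Properties as ℕ
  open import Data.Integer using (ℤ; +_; +≤+; 0ℤ; 1ℤ; _+_; _-_; _*_; -_; _≤_; ∣_∣)
  import Data.Integer.Properties as ℤ
  open import Data.Integer.Tactic.RingSolver using (solve-∀)
  open import Data.Fin using (Fin; toℕ; fromℕ<)
  import Data.Fin.Properties as Fin
  open import Data.Fin.Subset using (Subset; _∈_; _∉_)
  open import Data.Fin.Subset.Properties using (_∈?_)
  open import Data.Vec using (Vec; []; _∷_; tabulate)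
  import Data.Vec as Vec
  import Data.Vec.Properties as Vec
  open import Data.Vec.Relation.Unary.All using (All; []; _∷_)
  open import Data.Bool.Properties using (T-≡)
  open import Data.Product using (Σ-syntax; ∃-syntax; _×_; _,_)
  open import Data.Sum using (_⊎_; inj₁; inj₂)
  open import Data.Empty using (⊥; ⊥-elim)
  open import Function.Bundles using (_⇔_; mk⇔; Equivalence)
  open import Relation.Nullary using (¬_; Dec; yes; no)
  open import Relation.Nullary.Decidable using (_×-dec_; _⊎-dec_; isYes; toWitness; fromWitness)
  open import Relation.Binary.PropositionalEquality using (_≡_; refl; sym; trans; cong; cong₂; subst; module ≡-Reasoning)

  B : ℤ
  B = A + + w

  InS : ℤ → Set
  InS z = (A ≤ z ≤ B) ⊎ (+ n - B ≤ z ≤ + n - A)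

  InS? : ∀ z → Dec (InS z)
  InS? z = (A ℤ.≤? z ×-dec z ℤ.≤? B) ⊎-dec (+ n - B ℤ.≤? z ×-dec z ℤ.≤? + n - A)

  S : Subset n
  S = tabulate (λ x → isYes (InS? (+ toℕ x)))

  ∈S⇔InS : ∀ x → x ∈ S ⇔ InS (+ toℕ x)
  ∈S⇔InS x = mk⇔
    (λ x∈S → toWitness {a? = InS? (+ toℕ x)} (Equivalence.from T-≡ (trans (sym (Vec.lookup∘tabulate _ x)) (Vec.[]=⇒lookup x∈S))))
    (λ inS → Vec.lookup⇒[]= x S (trans (Vec.lookup∘tabulate _ x) (Equivalence.to T-≡ (fromWitness inS))))

  -- A residue lies outside S exactly when it has a representative in one of these two intervals.
  Gap : ℤ → Set
  Gap y = (1ℤ - A ≤ y ≤ A - 1ℤ) ⊎ (B + 1ℤ ≤ y ≤ + n - B - 1ℤ)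

  GapMod : ℤ → Set
  GapMod z = ∃[ K ] Gap (z + K * + n)

  lo hi : ℕ → ℕ → ℤ
  lo i j = + i * A - + j * B
  hi i j = + i * B - + j * A

  total : ∀ {L} → Vec (Fin n) L → ℕ
  total v = Vec.sum (Vec.map toℕ v)

  module _ {p : ℕ} where

    complement-index : ∀ {i j} → i ℕ.+ j ≡ p ℕ.+ p → + j ≡ + p + + p - + i
    complement-index {i} {j} i+j≡2p = begin
      + j                    ≡⟨ identity (+ i) (+ j) ⟩
      + i + + j - + i        ≡⟨ cong (_- + i) (sym (ℤ.pos-+ i j)) ⟩
      + (i ℕ.+ j) - + i      ≡⟨ cong (λ m → + m - + i) i+j≡2p ⟩
      + (p ℕ.+ p) - + i      ≡⟨ cong (_- + i) (ℤ.pos-+ p p) ⟩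
      + p + + p - + i        ∎
      where open ≡-Reasoning
            identity : ∀ i j → j ≡ i + j - i
            identity = solve-∀

    lo≤≤hi⇔Near : ∀ {i j y} → i ℕ.+ j ≡ p ℕ.+ p → (lo i j ≤ y ≤ hi i j) ⇔ Near (+ p * + w) ((+ i - + p) * (A + B)) y
    lo≤≤hi⇔Near {i} {j} i+j≡2p = mk⇔
      (λ bounds → let lower , upper = ≤≤-cast lo≡ refl hi≡ bounds in within lower upper)
      (λ (within lower upper) → ≤≤-cast (sym lo≡) refl (sym hi≡) (lower , upper))
      where
      j≡ : + j ≡ + p + + p - + i
      j≡ = complement-index i+j≡2p
      lo≡ : lo i j ≡ (+ i - + p) * (A + B) - + p * + w
      lo≡ = trans (cong (λ J → + i * A - J * B) j≡) (identity (+ i) (+ p) A (+ w))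
        where identity : ∀ i p A w → i * A - (p + p - i) * (A + w) ≡ (i - p) * (A + (A + w)) - p * w
              identity = solve-∀
      hi≡ : hi i j ≡ (+ i - + p) * (A + B) + + p * + w
      hi≡ = trans (cong (λ J → + i * B - J * A) j≡) (identity (+ i) (+ p) A (+ w))
        where identity : ∀ i p A w → i * (A + w) - (p + p - i) * A ≡ (i - p) * (A + (A + w)) + p * w
              identity = solve-∀

    index-bounds : ∀ {i j} → i ℕ.+ j ≡ p ℕ.+ p → - + p ≤ + i - + p ≤ + p
    index-bounds {i} {j} i+j≡2p =
      ≤-by (0≤+ i) (identity (+ i) (+ p)) ,
      ≤-by (0≤+ j) (trans (identity₂ (+ i) (+ p)) (sym (complement-index i+j≡2p)))
      where identity : ∀ i p → i - p - - p ≡ i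
            identity = solve-∀
            identity₂ : ∀ i p → p - (i - p) ≡ p + p - i
            identity₂ = solve-∀

    centred-index : ∀ {s} → - + p ≤ s ≤ + p → ∃[ i ] ∃[ j ] (i ℕ.+ j ≡ p ℕ.+ p × + i - + p ≡ s)
    centred-index {s} (-p≤s , s≤p) = ∣ s + + p ∣ , ∣ + p - s ∣ , ℤ.+-injective (begin
      + (∣ s + + p ∣ ℕ.+ ∣ + p - s ∣)    ≡⟨ ℤ.pos-+ ∣ s + + p ∣ ∣ + p - s ∣ ⟩
      + ∣ s + + p ∣ + + ∣ + p - s ∣      ≡⟨ cong₂ _+_ i≡ j≡ ⟩
      (s + + p) + (+ p - s)              ≡⟨ identity s (+ p) ⟩
      + p + + p                          ≡⟨ sym (ℤ.pos-+ p p) ⟩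
      + (p ℕ.+ p)                        ∎) ,
      trans (cong (_- + p) i≡) (identity₂ s (+ p))
      where
      open ≡-Reasoning
      i≡ : + ∣ s + + p ∣ ≡ s + + p
      i≡ = ℤ.0≤i⇒+∣i∣≡i (≤-via -p≤s (identity₃ s (+ p)))
        where identity₃ : ∀ s p → s + p - 0ℤ ≡ s - - p
              identity₃ = solve-∀
      j≡ : + ∣ + p - s ∣ ≡ + p - s
      j≡ = ℤ.0≤i⇒+∣i∣≡i (0≤- s≤p)
      identity : ∀ s p → (s + p) + (p - s) ≡ p + p
      identity = solve-∀
      identity₂ : ∀ s p → s + p - p ≡ s
      identity₂ = solve-∀

  module _ (1≤A : 1ℤ ≤ A) (A+B≤n : A + B ≤ + n) where

    private
      0≤A : 0ℤ ≤ A
      0≤A = ℤ.≤-trans (0≤+ 1) 1≤A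
      A≤B : A ≤ B
      A≤B = ≤-by (0≤+ w) (identity A (+ w))
        where identity : ∀ a w → a + w - a ≡ w
              identity = solve-∀

    toFin : ∀ {z} → 0ℤ ≤ z → 1ℤ + z ≤ + n → Σ[ x ∈ Fin n ] (+ toℕ x ≡ z)
    toFin {+ m} _ m<n = fromℕ< (ℤ.drop‿+≤+ m<n) , cong +_ (Fin.toℕ-fromℕ< _)

    InS⇒A≤z≤n-A : ∀ {z} → InS z → A ≤ z ≤ + n - A
    InS⇒A≤z≤n-A {z} (inj₁ (A≤z , z≤B)) = A≤z , ≤-by (0≤+0≤ (0≤- z≤B) (0≤- A+B≤n)) (identity A (+ w) z (+ n))
      where identity : ∀ A w z n → n - A - z ≡ (A + w - z) + (n - (A + (A + w)))
            identity = solve-∀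
    InS⇒A≤z≤n-A {z} (inj₂ (n-B≤z , z≤n-A)) = ≤-by (0≤+0≤ (0≤- n-B≤z) (0≤- A+B≤n)) (identity A (+ w) z (+ n)) , z≤n-A
      where identity : ∀ A w z n → z - A ≡ (z - (n - (A + w))) + (n - (A + (A + w)))
            identity = solve-∀

    InS⇒∈S : ∀ {z} → InS z → Σ[ x ∈ Fin n ] (x ∈ S × + toℕ x ≡ z)
    InS⇒∈S {z} inS with InS⇒A≤z≤n-A inS
    ... | A≤z , z≤n-A with toFin (ℤ.≤-trans 0≤A A≤z) (≤-by (0≤+0≤ (0≤- z≤n-A) (0≤- 1≤A)) (identity A z (+ n)))
      where identity : ∀ A z n → n - (1ℤ + z) ≡ (n - A - z) + (A - 1ℤ)
            identity = solve-∀
    ...   | x , x≡z = x , Equivalence.from (∈S⇔InS x) (subst InS (sym x≡z) inS) , x≡z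

    InS-reflect : ∀ {z} → InS z → InS (+ n - z)
    InS-reflect {z} (inj₁ (A≤z , z≤B)) =
      inj₂ (ℤ.+-monoʳ-≤ (+ n) (ℤ.neg-mono-≤ z≤B) , ℤ.+-monoʳ-≤ (+ n) (ℤ.neg-mono-≤ A≤z))
    InS-reflect {z} (inj₂ (n-B≤z , z≤n-A)) =
      inj₁ (≤-via z≤n-A (swap (+ n) A z) , ≤-via n-B≤z (move (+ n) B z))
      where swap : ∀ n a z → n - z - a ≡ n - a - z
            swap = solve-∀
            move : ∀ n b z → b - (n - z) ≡ z - (n - b)
            move = solve-∀

    S-symmetric : Symmetric S
    S-symmetric x x∈S =
      let y , y∈S , y≡n-x = InS⇒∈S (InS-reflect (Equivalence.to (∈S⇔InS x) x∈S))
      in y , y∈S , 1 , complementary y≡n-x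
      where
      complementary : ∀ {a b} → + b ≡ + n - + a → a ℕ.+ b ≡ 0 ℕ.+ 1 ℕ.* n
      complementary {a} {b} b≡n-a = ℤ.+-injective (begin
        + a + + b          ≡⟨ cong (λ m → + a + m) b≡n-a ⟩
        + a + (+ n - + a)  ≡⟨ cancel (+ a) (+ n) ⟩
        + n                ≡⟨ cong +_ (sym (ℕ.+-identityʳ n)) ⟩
        + (1 ℕ.* n)        ∎)
        where open ≡-Reasoning
              cancel : ∀ a b → a + (b - a) ≡ b
              cancel = solve-∀

    lo≤hi : ∀ i j → lo i j ≤ hi i j
    lo≤hi i j = ≤-by (0≤*0≤ (0≤+ (i ℕ.+ j)) (0≤+ w)) (trans (identity (+ i) (+ j) A (+ w)) (cong (_* + w) (sym (ℤ.pos-+ i j))))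
      where identity : ∀ i j A w → (i * (A + w) - j * A) - (i * A - j * (A + w)) ≡ (i + j) * w
            identity = solve-∀

    sum-bounds : ∀ {L} (v : Vec (Fin n) L) → All (_∈ S) v →
                 ∃[ i ] ∃[ j ] (i ℕ.+ j ≡ L × (lo i j ≤ + total v - + j * + n ≤ hi i j))
    sum-bounds [] [] = 0 , 0 , refl , ≤≤-cast (sym (zero-lo A B)) (zero-total (+ n)) (sym (zero-lo B A)) (ℤ.≤-refl , ℤ.≤-refl)
      where zero-lo : ∀ a b → + 0 * a - + 0 * b ≡ 0ℤ
            zero-lo = solve-∀
            zero-total : ∀ n → 0ℤ ≡ + 0 - + 0 * n
            zero-total = solve-∀
    sum-bounds (x ∷ v) (x∈S ∷ v⊆S) with sum-bounds v v⊆S | Equivalence.to (∈S⇔InS x) x∈S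
    ... | i , j , refl , bounds | inj₁ low =
      suc i , j , refl , ≤≤-cast (step A B (+ i) (+ j)) (split-sum (toℕ x) (total v) (+ j * + n)) (step B A (+ i) (+ j)) (≤≤-+ low bounds)
      where step : ∀ a b i j → a + (i * a - j * b) ≡ (1ℤ + i) * a - j * b
            step = solve-∀
            split-sum : ∀ a s J → + a + (+ s - J) ≡ + (a ℕ.+ s) - J
            split-sum a s J = trans (assoc (+ a) (+ s) J) (cong (_- J) (sym (ℤ.pos-+ a s)))
              where assoc : ∀ a s J → a + (s - J) ≡ (a + s) - J
                    assoc = solve-∀
    ... | i , j , refl , bounds | inj₂ high =
      i , suc j , ℕ.+-suc i j , ≤≤-cast (step A B (+ i) (+ j) (+ n)) (split-sum (toℕ x) (total v) (+ j) (+ n)) (step B A (+ i) (+ j) (+ n))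
                                        (≤≤-+ (≤≤-+ high bounds) (ℤ.≤-refl { - + n } , ℤ.≤-refl))
      where step : ∀ a b i j n → (n - b) + (i * a - j * b) + - n ≡ i * a - (1ℤ + j) * b
            step = solve-∀
            split-sum : ∀ a s j n → + a + (+ s - j * n) + - n ≡ + (a ℕ.+ s) - (1ℤ + j) * n
            split-sum a s j n = trans (assoc (+ a) (+ s) j n) (cong (λ t → t - (1ℤ + j) * n) (sym (ℤ.pos-+ a s)))
              where assoc : ∀ a s j n → a + (s - j * n) + - n ≡ (a + s) - (1ℤ + j) * n
                    assoc = solve-∀

    realize : ∀ i j {T} → lo i j ≤ T ≤ hi i j →
              Σ[ v ∈ Vec (Fin n) (i ℕ.+ j) ] (All (_∈ S) v × + total v ≡ T + + j * + n)
    realize zero zero {T} bounds = [] , [] , total-nil (≤≤-cast (zero-lo A B) refl (zero-lo B A) bounds)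
      where
      zero-lo : ∀ a b → + 0 * a - + 0 * b ≡ 0ℤ
      zero-lo = solve-∀
      total-nil : 0ℤ ≤ T ≤ 0ℤ → + 0 ≡ T + + 0 * + n
      total-nil (0≤T , T≤0) = trans (identity (+ n)) (cong (λ t → t + + 0 * + n) (ℤ.≤-antisym 0≤T T≤0))
        where identity : ∀ n → + 0 ≡ 0ℤ + + 0 * n
              identity = solve-∀
    realize (suc i) j {T} bounds =
      let a , A≤a≤B , rest = ≤≤-split A≤B (lo≤hi i j) (≤≤-cast (step A B (+ i) (+ j)) refl (step B A (+ i) (+ j)) bounds)
          v , v⊆S , Σv≡ = realize i j rest
          x , x∈S , x≡a = InS⇒∈S (inj₁ A≤a≤B)
      in x ∷ v , x∈S ∷ v⊆S , total-cons x≡a Σv≡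
      where
      step : ∀ a b i j → (1ℤ + i) * a - j * b ≡ a + (i * a - j * b)
      step = solve-∀
      total-cons : ∀ {x s a} → + x ≡ a → + s ≡ (T - a) + + j * + n → + (x ℕ.+ s) ≡ T + + j * + n
      total-cons {x} refl s≡ = trans (cong (λ m → + x + m) s≡) (identity (+ x) T (+ j * + n))
        where identity : ∀ a T J → a + ((T - a) + J) ≡ T + J
              identity = solve-∀
    realize zero (suc j) {T} bounds =
      let a , -B≤a≤-A , rest = ≤≤-split (ℤ.neg-mono-≤ A≤B) (lo≤hi 0 j) (≤≤-cast (step A B (+ j)) refl (step B A (+ j)) bounds)
          v , v⊆S , Σv≡ = realize zero j rest
          x , x∈S , x≡n+a = InS⇒∈S (inj₂ (≤≤-+ (ℤ.≤-refl { + n } , ℤ.≤-refl) -B≤a≤-A))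
      in x ∷ v , x∈S ∷ v⊆S , total-cons x≡n+a Σv≡
      where
      step : ∀ a b j → + 0 * a - (1ℤ + j) * b ≡ - b + (+ 0 * a - j * b)
      step = solve-∀
      total-cons : ∀ {x s a} → + x ≡ + n + a → + s ≡ (T - a) + + j * + n → + (x ℕ.+ s) ≡ T + (1ℤ + + j) * + n
      total-cons {a = a} x≡ s≡ = trans (cong₂ _+_ x≡ s≡) (identity (+ n) a T (+ j))
        where identity : ∀ n a T j → (n + a) + ((T - a) + j * n) ≡ T + (1ℤ + j) * n
              identity = solve-∀

    InSumset⇒near : ∀ {ℓ x} → InSumset ℓ S x →
                    ∃[ i ] ∃[ j ] ∃[ K ] (i ℕ.+ j ≡ ℓ × (lo i j ≤ + toℕ x + K * + n ≤ hi i j))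
    InSumset⇒near (v , v⊆S , q , Σv≡) =
      let i , j , i+j≡ℓ , bounds = sum-bounds v v⊆S
      in i , j , + q - + j , i+j≡ℓ , ≤≤-cast refl (ModEq⇒ℤ j Σv≡) refl bounds

    near⇒InSumset : ∀ {x} i j K → lo i j ≤ + toℕ x + K * + n ≤ hi i j → InSumset (i ℕ.+ j) S x
    near⇒InSumset {x} i j K bounds =
      let v , v⊆S , Σv≡ = realize i j bounds
      in v , v⊆S , ℤ⇒ModEq (K + + j) (Fin.toℕ<n x) (trans Σv≡ (distrib (+ toℕ x) K (+ j) (+ n)))
      where distrib : ∀ z K j n → z + K * n + j * n ≡ z + (K + j) * n
            distrib = solve-∀

    private
      2A≤n : A + A ≤ + n
      2A≤n = ℤ.≤-trans (ℤ.+-monoʳ-≤ A A≤B) A+B≤n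

    -- [1 - A, n - A] is a window of length n containing both pieces of S and both gaps, and a
    -- residue has only one representative there.
    InS⇒window : ∀ {z} → InS z → 1ℤ - A ≤ z ≤ + n - A
    InS⇒window inS with InS⇒A≤z≤n-A inS
    ... | A≤z , z≤n-A = ℤ.≤-trans (≤-by (0≤+0≤ (0≤- 1≤A) 0≤A) (identity A)) A≤z , z≤n-A
      where identity : ∀ A → A - (1ℤ - A) ≡ (A - 1ℤ) + A
            identity = solve-∀

    Gap⇒window : ∀ {y} → Gap y → 1ℤ - A ≤ y ≤ + n - A
    Gap⇒window {y} (inj₁ (low , y≤A-1)) = low , ≤-by (0≤+0≤ (0≤- y≤A-1) (0≤+0≤ (0≤- 2A≤n) (0≤+ 1))) (identity A y (+ n))
      where identity : ∀ A y n → n - A - y ≡ (A - 1ℤ - y) + ((n - (A + A)) + 1ℤ)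
            identity = solve-∀
    Gap⇒window {y} (inj₂ (B+1≤y , y≤n-B-1)) =
      ≤-by (0≤+0≤ (0≤+0≤ (0≤+0≤ (0≤- B+1≤y) 0≤A) (0≤+ w)) 0≤A) (identity₁ A (+ w) y) ,
      ≤-by (0≤+0≤ (0≤+0≤ (0≤- y≤n-B-1) (0≤+ w)) (0≤+ 1)) (identity₂ A (+ w) y (+ n))
      where identity₁ : ∀ A w y → y - (1ℤ - A) ≡ (y - (A + w + 1ℤ)) + A + w + A
            identity₁ = solve-∀
            identity₂ : ∀ A w y n → n - A - y ≡ (n - (A + w) - 1ℤ - y) + w + 1ℤ
            identity₂ = solve-∀

    InS-Gap-disjoint : ∀ {z} → InS z → Gap z → ⊥
    InS-Gap-disjoint (inj₁ (A≤z , _)) (inj₁ (_ , z≤A-1)) = separated z≤A-1 (ℤ.≤-reflexive (identity A)) A≤z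
      where identity : ∀ A → 1ℤ + (A - 1ℤ) ≡ A
            identity = solve-∀
    InS-Gap-disjoint (inj₁ (_ , z≤B)) (inj₂ (B+1≤z , _)) = separated z≤B (ℤ.≤-reflexive (ℤ.+-comm 1ℤ B)) B+1≤z
    InS-Gap-disjoint (inj₂ (n-B≤z , _)) (inj₁ (_ , z≤A-1)) = separated z≤A-1 (≤-via A+B≤n (identity A B (+ n))) n-B≤z
      where identity : ∀ A B n → n - B - (1ℤ + (A - 1ℤ)) ≡ n - (A + B)
            identity = solve-∀
    InS-Gap-disjoint (inj₂ (n-B≤z , _)) (inj₂ (_ , z≤n-B-1)) = separated z≤n-B-1 (ℤ.≤-reflexive (identity B (+ n))) n-B≤z
      where identity : ∀ B n → 1ℤ + (n - B - 1ℤ) ≡ n - B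
            identity = solve-∀

    ∈S⇒¬GapMod : ∀ {x} → x ∈ S → ¬ GapMod (+ toℕ x)
    ∈S⇒¬GapMod {x} x∈S (K , gap) = InS-Gap-disjoint inS
      (subst Gap (window-unique K (0≤+ n) (ℤ.≤-reflexive (identity A (+ n))) (InS⇒window inS) (Gap⇒window gap)) gap)
      where inS : InS (+ toℕ x)
            inS = Equivalence.to (∈S⇔InS x) x∈S
            identity : ∀ A n → n - A + 1ℤ ≡ 1ℤ - A + n
            identity = solve-∀

    ∉S⇒GapMod : ∀ {x} → x ∉ S → GapMod (+ toℕ x)
    ∉S⇒GapMod {x} x∉S = classify (0≤+ (toℕ x)) (+≤+ (Fin.toℕ<n x)) (λ inS → x∉S (Equivalence.from (∈S⇔InS x) inS))
      where
      unshifted : ∀ {y} → Gap y → GapMod y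
      unshifted {y} gap = 0ℤ , subst Gap (identity y (+ n)) gap
        where identity : ∀ y n → y ≡ y + 0ℤ * n
              identity = solve-∀
      classify : ∀ {z} → 0ℤ ≤ z → 1ℤ + z ≤ + n → ¬ InS z → GapMod z
      classify {z} 0≤z z<n ¬inS with z ℤ.≤? A - 1ℤ
      ... | yes z≤A-1 = unshifted (inj₁ (ℤ.≤-trans (≤-via 1≤A (identity A)) 0≤z , z≤A-1))
        where identity : ∀ A → 0ℤ - (1ℤ - A) ≡ A - 1ℤ
              identity = solve-∀
      ... | no z≰A-1 with z ℤ.≤? B
      ...   | yes z≤B = ⊥-elim (¬inS (inj₁ (≤-via (≰⇒suc≤ z≰A-1) (identity A z) , z≤B)))
        where identity : ∀ A z → z - A ≡ z - (1ℤ + (A - 1ℤ))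
              identity = solve-∀
      ...   | no z≰B with z ℤ.≤? + n - B - 1ℤ
      ...     | yes z≤n-B-1 = unshifted (inj₂ (ℤ.≤-trans (ℤ.≤-reflexive (ℤ.+-comm B 1ℤ)) (≰⇒suc≤ z≰B) , z≤n-B-1))
      ...     | no z≰n-B-1 with z ℤ.≤? + n - A
      ...       | yes z≤n-A = ⊥-elim (¬inS (inj₂ (≤-via (≰⇒suc≤ z≰n-B-1) (identity B z (+ n)) , z≤n-A)))
        where identity : ∀ B z n → z - (n - B) ≡ z - (1ℤ + (n - B - 1ℤ))
              identity = solve-∀
      ...       | no z≰n-A = - 1ℤ , inj₁ (≤-via (≰⇒suc≤ z≰n-A) (identity₁ A z (+ n)) ,
                                         ≤-by (0≤+0≤ (0≤- z<n) 0≤A) (identity₂ A z (+ n)))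
        where identity₁ : ∀ A z n → z + - 1ℤ * n - (1ℤ - A) ≡ z - (1ℤ + (n - A))
              identity₁ = solve-∀
              identity₂ : ∀ A z n → A - 1ℤ - (z + - 1ℤ * n) ≡ (n - (1ℤ + z)) + A
              identity₂ = solve-∀

    complete-sum-free : ∀ {ℓ} p → ℓ ≡ p ℕ.+ p →
      (∀ {s T} → - + p ≤ s ≤ + p → Near (+ p * + w) (s * (A + B)) T → GapMod T) →
      (∀ {y} → Gap y → ∃[ s ] ∃[ K ] ((- + p ≤ s ≤ + p) × Near (+ p * + w) (s * (A + B)) (y + K * + n))) →
      CompleteSumFree ℓ S
    complete-sum-free p refl sumsets-avoid-S gaps-covered = sum-free , covering
      where
      shift-twice : ∀ z K K′ → z + K * + n + K′ * + n ≡ z + (K + K′) * + n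
      shift-twice z K K′ = identity z K K′ (+ n)
        where identity : ∀ z K K′ n → z + K * n + K′ * n ≡ z + (K + K′) * n
              identity = solve-∀
      sum-free : SumFree (p ℕ.+ p) S
      sum-free x x∈pS x∈S =
        let i , j , K , i+j≡2p , bounds = InSumset⇒near x∈pS
            K′ , gap = sumsets-avoid-S (index-bounds {p} i+j≡2p) (Equivalence.to (lo≤≤hi⇔Near {p} {i} {j} i+j≡2p) bounds)
        in ∈S⇒¬GapMod x∈S (K + K′ , subst Gap (shift-twice (+ toℕ x) K K′) gap)
      covering : ∀ x → x ∈ S ⊎ InSumset (p ℕ.+ p) S x
      covering x with x ∈? S
      ... | yes x∈S = inj₁ x∈S
      ... | no x∉S =
        let K , gap = ∉S⇒GapMod x∉S
            s , K′ , s-bounds , near = gaps-covered gap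
            i , j , i+j≡2p , i-p≡s = centred-index {p} s-bounds
            near′ = subst (λ s → Near (+ p * + w) (s * (A + B)) (+ toℕ x + (K + K′) * + n))
                          (sym i-p≡s) (subst (Near (+ p * + w) (s * (A + B))) (shift-twice (+ toℕ x) K K′) near)
        in inj₂ (subst (λ L → InSumset L S x) i+j≡2p
                   (near⇒InSumset i j (K + K′) (Equivalence.from (lo≤≤hi⇔Near {p} {i} {j} i+j≡2p) near′)))

module Construction where

  open IntegerIntervals
  open import Defs
  open import Data.Nat as ℕ using (ℕ; zero; suc)
  import Data.Nat.Properties as ℕ
  open import Data.Integer using (ℤ; +_; -[1+_]; +≤+; 0ℤ; 1ℤ; _+_; _-_; _*_; -_; _≤_; ∣_∣)
  import Data.Integer.Properties as ℤ
  open import Data.Integer.Tactic.RingSolver using (solve-∀)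
  open import Data.Fin.Subset using (Subset)
  open import Data.Product using (Σ-syntax; ∃-syntax; _×_; _,_)
  open import Data.Sum using (_⊎_; inj₁; inj₂)
  open import Relation.Binary.PropositionalEquality using (_≡_; refl; sym; trans; cong; cong₂; subst)

  -- The parity of p = 2q or 2q + 1 fixes the sign of d = ±D in the modulus n = 2C - d.
  data Shape (q D : ℕ) : ℕ → ℤ → Set where
    even : Shape q D (q ℕ.+ q) (+ D)
    odd  : Shape q D (suc (q ℕ.+ q)) (- + D)

  module Parameters (q D w : ℕ) where

    R : ℕ → ℤ
    R p = + p * + w

    A : ℕ → ℤ
    A p = 1ℤ + + q * + D + R p

    C : ℕ → ℤ
    C p = A p + (A p + + w)

    module _ {p n : ℕ} {d : ℤ} (n≡ : + n ≡ + 2 * C p - d) where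

      open IntervalSubset n (A p) w

      near-centre⇒Gap₀ : ∀ {c y} → (- + q) * + D ≤ c ≤ + q * + D → Near (R p) c y → Gap y
      near-centre⇒Gap₀ {c} {y} (-qD≤c , c≤qD) (within lo hi) = inj₁
        (≤-by (0≤+0≤ (0≤- lo) (0≤- -qD≤c)) (identity₁ (+ q) (+ D) (R p) c y) ,
         ≤-by (0≤+0≤ (0≤- hi) (0≤- c≤qD)) (identity₂ (+ q) (+ D) (R p) c y))
        where identity₁ : ∀ q D R c y → y - (1ℤ - (1ℤ + q * D + R)) ≡ (y - (c - R)) + (c - (- q) * D)
              identity₁ = solve-∀
              identity₂ : ∀ q D R c y → 1ℤ + q * D + R - 1ℤ - y ≡ (c + R - y) + (q * D - c)
              identity₂ = solve-∀

      near-centre⇒Gap₁ : ∀ {c y} → (- + q) * + D ≤ c ≤ + q * + D - d → Near (R p) (C p + c) y → Gap y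
      near-centre⇒Gap₁ {c} {y} (-qD≤c , c≤qD-d) (within lo hi) = inj₂
        (≤-by (0≤+0≤ (0≤- lo) (0≤- -qD≤c)) (identity₁ (+ q) (+ D) (R p) (+ w) c y) ,
         ≤-by (0≤+0≤ (0≤- hi) (0≤- c≤qD-d)) (trans (cong (λ m → m - (A p + + w) - 1ℤ - y) n≡) (identity₂ (+ q) (+ D) (R p) (+ w) d c y)))
        where identity₁ : ∀ q D R w c y → y - ((1ℤ + q * D + R) + w + 1ℤ) ≡ (y - ((1ℤ + q * D + R) + ((1ℤ + q * D + R) + w) + c - R)) + (c - (- q) * D)
              identity₁ = solve-∀
              identity₂ : ∀ q D R w d c y →
                + 2 * ((1ℤ + q * D + R) + ((1ℤ + q * D + R) + w)) - d - ((1ℤ + q * D + R) + w) - 1ℤ - y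
                ≡ ((1ℤ + q * D + R) + ((1ℤ + q * D + R) + w) + c + R - y) + (q * D - d - c)
              identity₂ = solve-∀

      Gap⇒near-centres : ∀ {y} → Gap y →
        ((- + q) * + D - R p ≤ y ≤ + q * + D + R p) ⊎ ((- + q) * + D - R p ≤ y - C p ≤ (+ q * + D - d) + R p)
      Gap⇒near-centres {y} (inj₁ (lo , hi)) = inj₁
        (≤-via lo (identity₁ (+ q) (+ D) (R p) y) , ≤-via hi (identity₂ (+ q) (+ D) (R p) y))
        where identity₁ : ∀ q D R y → y - ((- q) * D - R) ≡ y - (1ℤ - (1ℤ + q * D + R))
              identity₁ = solve-∀
              identity₂ : ∀ q D R y → q * D + R - y ≡ 1ℤ + q * D + R - 1ℤ - y
              identity₂ = solve-∀
      Gap⇒near-centres {y} (inj₂ (lo , hi)) = inj₂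
        (≤-via lo (identity₁ (+ q) (+ D) (R p) (+ w) y) ,
         ≤-via hi (trans (identity₂ (+ q) (+ D) (R p) (+ w) d y) (cong (λ m → m - (A p + + w) - 1ℤ - y) (sym n≡))))
        where identity₁ : ∀ q D R w y → y - ((1ℤ + q * D + R) + ((1ℤ + q * D + R) + w)) - ((- q) * D - R) ≡ y - ((1ℤ + q * D + R) + w + 1ℤ)
              identity₁ = solve-∀
              identity₂ : ∀ q D R w d y →
                (q * D - d) + R - (y - ((1ℤ + q * D + R) + ((1ℤ + q * D + R) + w)))
                ≡ + 2 * ((1ℤ + q * D + R) + ((1ℤ + q * D + R) + w)) - d - ((1ℤ + q * D + R) + w) - 1ℤ - y
              identity₂ = solve-∀

    private
      twice-C : ∀ v c D → (v + v) * c ≡ v * D + v * (+ 2 * c - D)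
      twice-C = solve-∀
      twice-C+1 : ∀ v c D → (1ℤ + (v + v)) * c ≡ (c + v * D) + v * (+ 2 * c - D)
      twice-C+1 = solve-∀
      twice-C-odd : ∀ v c D → (v + v) * c ≡ (- v) * D + v * (+ 2 * c - - D)
      twice-C-odd = solve-∀
      twice-C+1-odd : ∀ v c D → (1ℤ + (v + v)) * c ≡ (c + (- v) * D) + v * (+ 2 * c - - D)
      twice-C+1-odd = solve-∀
      minus-twice-C-odd : ∀ v c D → (- (v + v)) * c ≡ v * D + (- v) * (+ 2 * c - - D)
      minus-twice-C-odd = solve-∀
      minus-twice-C+1-odd : ∀ v c D → (1ℤ - (v + v)) * c ≡ (c + v * D) + (- v) * (+ 2 * c - - D)
      minus-twice-C+1-odd = solve-∀
      pos-double : + (q ℕ.+ q) ≡ + q + + q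
      pos-double = ℤ.pos-+ q q

    sumsets-avoid-S : ∀ {p n d} → Shape q D p d → + n ≡ + 2 * C p - d →
      ∀ {s T} → - + p ≤ s ≤ + p → Near (R p) (s * C p) T → IntervalSubset.GapMod n (A p) w T
    sumsets-avoid-S {p} {n} even n≡ {s} s-bounds near with even-or-odd s | ≤≤-cast (cong -_ pos-double) refl pos-double s-bounds
    ... | v , inj₁ refl | lo , hi =
      - v , near-centre⇒Gap₀ {p} n≡ (≤≤-*-nonNeg (0≤+ D) v-bounds)
              (uncentre v (+ n) (trans (twice-C v (C p) (+ D)) (cong (λ m → v * + D + v * m) (sym n≡))) near)
      where
      v-bounds : - + q ≤ v ≤ + q
      v-bounds = halve-≤ (≤-by (0≤+0≤ (0≤- lo) (0≤+ 1)) (identity₁ (+ q) v)) ,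
                 halve-≤ (≤-by (0≤+0≤ (0≤- hi) (0≤+ 1)) (identity₂ (+ q) v))
        where identity₁ : ∀ q v → + 2 * v + 1ℤ - + 2 * - q ≡ (v + v - - (q + q)) + 1ℤ
              identity₁ = solve-∀
              identity₂ : ∀ q v → + 2 * q + 1ℤ - + 2 * v ≡ (q + q - (v + v)) + 1ℤ
              identity₂ = solve-∀
    ... | v , inj₂ refl | lo , hi =
      - v , near-centre⇒Gap₁ {p} n≡ (≤≤-cast refl refl (identity (+ q) (+ D)) (≤≤-*-nonNeg (0≤+ D) v-bounds))
              (uncentre v (+ n) (trans (twice-C+1 v (C p) (+ D)) (cong (λ m → (C p + v * + D) + v * m) (sym n≡))) near)
      where
      identity : ∀ q D → (q - 1ℤ) * D ≡ q * D - D
      identity = solve-∀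
      v-bounds : - + q ≤ v ≤ + q - 1ℤ
      v-bounds = halve-≤ (≤-via lo (identity₁ (+ q) v)) , halve-≤ (≤-via hi (identity₂ (+ q) v))
        where identity₁ : ∀ q v → + 2 * v + 1ℤ - + 2 * - q ≡ 1ℤ + (v + v) - - (q + q)
              identity₁ = solve-∀
              identity₂ : ∀ q v → + 2 * (q - 1ℤ) + 1ℤ - + 2 * v ≡ q + q - (1ℤ + (v + v))
              identity₂ = solve-∀
    sumsets-avoid-S {p} {n} odd n≡ {s} s-bounds near
      with even-or-odd s | ≤≤-cast (cong (λ m → - (1ℤ + m)) pos-double) refl (cong (λ m → 1ℤ + m) pos-double) s-bounds
    ... | v , inj₁ refl | lo , hi =
      - v , near-centre⇒Gap₀ {p} n≡ (≤≤-*-nonNeg (0≤+ D) -v-bounds)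
              (uncentre v (+ n) (trans (twice-C-odd v (C p) (+ D)) (cong (λ m → (- v) * + D + v * m) (sym n≡))) near)
      where
      v-bounds : - + q ≤ v ≤ + q
      v-bounds = halve-≤ (≤-via lo (identity₁ (+ q) v)) , halve-≤ (≤-via hi (identity₂ (+ q) v))
        where identity₁ : ∀ q v → + 2 * v + 1ℤ - + 2 * - q ≡ v + v - - (1ℤ + (q + q))
              identity₁ = solve-∀
              identity₂ : ∀ q v → + 2 * q + 1ℤ - + 2 * v ≡ 1ℤ + (q + q) - (v + v)
              identity₂ = solve-∀
      -v-bounds : - + q ≤ - v ≤ + q
      -v-bounds = ≤≤-cast refl refl (ℤ.neg-involutive (+ q)) (≤≤-neg v-bounds)
    ... | v , inj₂ refl | lo , hi =
      - v , near-centre⇒Gap₁ {p} n≡ (≤≤-cast refl refl (identity (+ q) (+ D)) (≤≤-*-nonNeg (0≤+ D) -v-bounds))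
              (uncentre v (+ n) (trans (twice-C+1-odd v (C p) (+ D)) (cong (λ m → (C p + (- v) * + D) + v * m) (sym n≡))) near)
      where
      identity : ∀ q D → (q + 1ℤ) * D ≡ q * D - - D
      identity = solve-∀
      v-bounds : - 1ℤ - + q ≤ v ≤ + q
      v-bounds = halve-≤ (≤-by (0≤+0≤ (0≤- lo) (0≤+ 1)) (identity₁ (+ q) v)) ,
                 halve-≤ (≤-by (0≤+0≤ (0≤- hi) (0≤+ 1)) (identity₂ (+ q) v))
        where identity₁ : ∀ q v → + 2 * v + 1ℤ - + 2 * (- 1ℤ - q) ≡ (1ℤ + (v + v) - - (1ℤ + (q + q))) + 1ℤ
              identity₁ = solve-∀
              identity₂ : ∀ q v → + 2 * q + 1ℤ - + 2 * v ≡ (1ℤ + (q + q) - (1ℤ + (v + v))) + 1ℤ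
              identity₂ = solve-∀
      -v-bounds : - + q ≤ - v ≤ + q + 1ℤ
      -v-bounds = ≤≤-cast refl refl (identity′ (+ q)) (≤≤-neg v-bounds)
        where identity′ : ∀ q → - (- 1ℤ - q) ≡ q + 1ℤ
              identity′ = solve-∀

    gaps-covered : ∀ {p n d} → Shape q D p d → 1 ℕ.≤ q → + D ≤ + 2 * R p + 1ℤ → + n ≡ + 2 * C p - d →
      ∀ {y} → IntervalSubset.Gap n (A p) w y →
      ∃[ s ] ∃[ K ] ((- + p ≤ s ≤ + p) × Near (R p) (s * C p) (y + K * + n))
    gaps-covered {p} {n} even 1≤q D≤2R+1 n≡ {y} gap with Gap⇒near-centres {p} n≡ gap
    ... | inj₁ range with cover D≤2R+1 { - + q } {+ q} (≤-by (0≤+0≤ (0≤+ q) (0≤+ q)) (identity (+ q))) range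
      where identity : ∀ q → q - - q ≡ q + q
            identity = solve-∀
    ...   | v , (lo , hi) , near =
      v + v , v ,
      ≤≤-cast (cong -_ (sym pos-double)) refl (sym pos-double)
        (≤-by (0≤+0≤ (0≤- lo) (0≤- lo)) (identity₁ (+ q) v) , ≤-by (0≤+0≤ (0≤- hi) (0≤- hi)) (identity₂ (+ q) v)) ,
      recentre v (+ n) (trans (twice-C v (C p) (+ D)) (cong (λ m → v * + D + v * m) (sym n≡))) near
      where identity₁ : ∀ q v → v + v - - (q + q) ≡ (v - - q) + (v - - q)
            identity₁ = solve-∀
            identity₂ : ∀ q v → q + q - (v + v) ≡ (q - v) + (q - v)
            identity₂ = solve-∀
    gaps-covered {p} {n} even 1≤q D≤2R+1 n≡ {y} gap | inj₂ range
      with cover D≤2R+1 { - + q } {+ q - 1ℤ} (≤-by (0≤+0≤ (0≤- (+≤+ 1≤q)) (0≤+ q)) (identity (+ q)))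
                 (≤≤-cast refl refl (identity′ (+ q) (+ D) (R p)) range)
      where identity : ∀ q → q - 1ℤ - - q ≡ (q - 1ℤ) + q
            identity = solve-∀
            identity′ : ∀ q D R → (q * D - D) + R ≡ (q - 1ℤ) * D + R
            identity′ = solve-∀
    ...   | v , (lo , hi) , near =
      1ℤ + (v + v) , v ,
      ≤≤-cast (cong -_ (sym pos-double)) refl (sym pos-double)
        (≤-by (0≤+0≤ (0≤+0≤ (0≤- lo) (0≤- lo)) (0≤+ 1)) (identity₁ (+ q) v) ,
         ≤-by (0≤+0≤ (0≤+0≤ (0≤- hi) (0≤- hi)) (0≤+ 1)) (identity₂ (+ q) v)) ,
      recentre v (+ n) (trans (twice-C+1 v (C p) (+ D)) (cong (λ m → (C p + v * + D) + v * m) (sym n≡))) (Near-shift {y = y} (C p) near)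
      where identity₁ : ∀ q v → 1ℤ + (v + v) - - (q + q) ≡ (v - - q) + (v - - q) + 1ℤ
            identity₁ = solve-∀
            identity₂ : ∀ q v → q + q - (1ℤ + (v + v)) ≡ (q - 1ℤ - v) + (q - 1ℤ - v) + 1ℤ
            identity₂ = solve-∀
    gaps-covered {p} {n} odd 1≤q D≤2R+1 n≡ {y} gap with Gap⇒near-centres {p} n≡ gap
    ... | inj₁ range with cover D≤2R+1 { - + q } {+ q} (≤-by (0≤+0≤ (0≤+ q) (0≤+ q)) (identity (+ q))) range
      where identity : ∀ q → q - - q ≡ q + q
            identity = solve-∀
    ...   | v , (lo , hi) , near =
      - (v + v) , - v ,
      ≤≤-cast (cong (λ m → - (1ℤ + m)) (sym pos-double)) refl (cong (λ m → 1ℤ + m) (sym pos-double))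
        (≤-by (0≤+0≤ (0≤+0≤ (0≤- hi) (0≤- hi)) (0≤+ 1)) (identity₁ (+ q) v) ,
         ≤-by (0≤+0≤ (0≤+0≤ (0≤- lo) (0≤- lo)) (0≤+ 1)) (identity₂ (+ q) v)) ,
      recentre (- v) (+ n) (trans (minus-twice-C-odd v (C p) (+ D)) (cong (λ m → v * + D + (- v) * m) (sym n≡))) near
      where identity₁ : ∀ q v → - (v + v) - - (1ℤ + (q + q)) ≡ (q - v) + (q - v) + 1ℤ
            identity₁ = solve-∀
            identity₂ : ∀ q v → 1ℤ + (q + q) - - (v + v) ≡ (v - - q) + (v - - q) + 1ℤ
            identity₂ = solve-∀
    gaps-covered {p} {n} odd 1≤q D≤2R+1 n≡ {y} gap | inj₂ range
      with cover D≤2R+1 { - + q } {+ q + 1ℤ} (≤-by (0≤+0≤ (0≤+0≤ (0≤+ q) (0≤+ q)) (0≤+ 1)) (identity (+ q)))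
                 (≤≤-cast refl refl (identity′ (+ q) (+ D) (R p)) range)
      where identity : ∀ q → q + 1ℤ - - q ≡ q + q + 1ℤ
            identity = solve-∀
            identity′ : ∀ q D R → (q * D - - D) + R ≡ (q + 1ℤ) * D + R
            identity′ = solve-∀
    ...   | v , (lo , hi) , near =
      1ℤ - (v + v) , - v ,
      ≤≤-cast (cong (λ m → - (1ℤ + m)) (sym pos-double)) refl (cong (λ m → 1ℤ + m) (sym pos-double))
        (≤-by (0≤+0≤ (0≤- hi) (0≤- hi)) (identity₁ (+ q) v) , ≤-by (0≤+0≤ (0≤- lo) (0≤- lo)) (identity₂ (+ q) v)) ,
      recentre (- v) (+ n) (trans (minus-twice-C+1-odd v (C p) (+ D)) (cong (λ m → (C p + v * + D) + (- v) * m) (sym n≡)))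
        (Near-shift {y = y} (C p) near)
      where identity₁ : ∀ q v → 1ℤ - (v + v) - - (1ℤ + (q + q)) ≡ (q + 1ℤ - v) + (q + 1ℤ - v)
            identity₁ = solve-∀
            identity₂ : ∀ q v → 1ℤ + (q + q) - (1ℤ - (v + v)) ≡ (v - - q) + (v - - q)
            identity₂ = solve-∀

    C≤n : ∀ {p n d} → Shape q D p d → 1 ℕ.≤ q → + n ≡ + 2 * C p - d → C p ≤ + n
    C≤n {p} even 1≤q n≡ =
      ≤-by (0≤+0≤ (0≤+0≤ (0≤*0≤ (0≤- (+≤+ 1≤q)) (0≤+ D)) (0≤*0≤ (0≤+ 2) (0≤*0≤ (0≤+ p) (0≤+ w))))
                  (0≤+0≤ (0≤+ (2 ℕ.+ w)) (0≤*0≤ (0≤+ q) (0≤+ D))))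
           (trans (cong (_- C p) n≡) (identity (+ q) (+ D) (+ p) (+ w)))
      where identity : ∀ q D p w → let c = (1ℤ + q * D + p * w) + ((1ℤ + q * D + p * w) + w) in
              + 2 * c - D - c ≡ ((q - 1ℤ) * D + + 2 * (p * w)) + ((+ 2 + w) + q * D)
            identity = solve-∀
    C≤n {p} odd _ n≡ =
      ≤-by (0≤+0≤ (0≤+ D) (0≤+0≤ (0≤+0≤ (0≤+ (2 ℕ.+ w)) (0≤*0≤ (0≤+ 2) (0≤*0≤ (0≤+ q) (0≤+ D)))) (0≤*0≤ (0≤+ 2) (0≤*0≤ (0≤+ p) (0≤+ w)))))
           (trans (cong (_- C p) n≡) (identity (+ q) (+ D) (+ p) (+ w)))
      where identity : ∀ q D p w → let c = (1ℤ + q * D + p * w) + ((1ℤ + q * D + p * w) + w) in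
              + 2 * c - - D - c ≡ D + (((+ 2 + w) + + 2 * (q * D)) + + 2 * (p * w))
            identity = solve-∀

    construction : ∀ {ℓ p n d} → Shape q D p d → 1 ℕ.≤ q → + D ≤ + 2 * R p + 1ℤ → + n ≡ + 2 * C p - d → ℓ ≡ p ℕ.+ p →
                   Σ[ S ∈ Subset n ] (Symmetric S × CompleteSumFree ℓ S)
    construction {ℓ} {p} {n} shape 1≤q D≤2R+1 n≡ ℓ≡2p =
      S , S-symmetric 1≤A (C≤n shape 1≤q n≡) ,
      complete-sum-free 1≤A (C≤n shape 1≤q n≡) p ℓ≡2p (sumsets-avoid-S shape n≡) (gaps-covered shape 1≤q D≤2R+1 n≡)
      where
      open IntervalSubset n (A p) w
      1≤A : 1ℤ ≤ A p
      1≤A = ≤-by (0≤+0≤ (0≤*0≤ (0≤+ q) (0≤+ D)) (0≤*0≤ (0≤+ p) (0≤+ w))) (identity (+ q) (+ D) (R p))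
        where identity : ∀ q D R → 1ℤ + q * D + R - 1ℤ ≡ q * D + R
              identity = solve-∀

  shape-of : ∀ D p → ∃[ q ] ∃[ d ] Shape q D p d
  shape-of D zero = 0 , + D , even
  shape-of D (suc p) with shape-of D p
  ... | q , _ , even = q , - + D , odd
  ... | q , _ , odd = suc q , + D , subst (λ m → Shape (suc q) D m (+ D)) (cong suc (ℕ.+-suc q q)) even

  Shape⇒1≤q : ∀ {q D p d} → Shape q D p d → 2 ℕ.≤ p → 1 ℕ.≤ q
  Shape⇒1≤q {suc q} _ _ = ℕ.s≤s ℕ.z≤n
  Shape⇒1≤q {zero} odd (ℕ.s≤s ())

  Shape⇒parity : ∀ {q D p d} → Shape q D p d →
                 (+ p ≡ + q + + q × d ≡ + D) ⊎ (+ p ≡ 1ℤ + (+ q + + q) × d ≡ - + D)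
  Shape⇒parity even = inj₁ (refl , refl)
  Shape⇒parity odd = inj₂ (refl , refl)

  0≤∣i∣+i : ∀ i → 0ℤ ≤ + ∣ i ∣ + i
  0≤∣i∣+i (+ g) = 0≤+ (g ℕ.+ g)
  0≤∣i∣+i -[1+ g ] = ℤ.≤-reflexive (sym (ℤ.+-inverseʳ (+ suc g)))

  k-large⇒width : ∀ {t p k} γ → 2 ℕ.≤ p → 4 ℕ.* t ℕ.+ 2 ℕ.* (p ℕ.* 2) ℕ.+ 2 ℕ.* ∣ γ ∣ ℕ.+ 2 ℕ.≤ k →
          ∃[ w ] (+ w ≡ + k + γ - + t - + 2 × + t + + 2 ≤ + w)
  k-large⇒width {t} {p} {k} γ 2≤p k-large =
    ∣ W ∣ , w≡ , ℤ.≤-trans t+2≤W (ℤ.≤-reflexive (sym w≡))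
    where
    W : ℤ
    W = + k + γ - + t - + 2
    k-large′ : + 4 * + t + + 2 * (+ p * + 2) + + 2 * + ∣ γ ∣ + + 2 ≤ + k
    k-large′ = subst (_≤ + k)
      (cong₂ _+_ (cong₂ _+_ (cong₂ _+_ (ℤ.pos-* 4 t) (trans (ℤ.pos-* 2 (p ℕ.* 2)) (cong (λ m → + 2 * m) (ℤ.pos-* p 2))))
                            (ℤ.pos-* 2 ∣ γ ∣)) refl)
      (+≤+ k-large)
    t+2≤W : + t + + 2 ≤ W
    t+2≤W = ≤-by (0≤+0≤ (0≤+0≤ (0≤+0≤ (0≤- k-large′) (0≤*0≤ (0≤+ 4) (0≤- (+≤+ 2≤p)))) (0≤+ (t ℕ.+ t ℕ.+ 6 ℕ.+ ∣ γ ∣)))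
                        (0≤∣i∣+i γ))
                 (identity (+ t) (+ p) (+ k) (+ ∣ γ ∣) γ)
      where identity : ∀ t p k g γ → k + γ - t - + 2 - (t + + 2) ≡
              (k - (+ 4 * t + + 2 * (p * + 2) + + 2 * g + + 2)) + + 4 * (p - + 2) + (t + t + + 6 + g) + (g + γ)
            identity = solve-∀
    w≡ : + ∣ W ∣ ≡ W
    w≡ = ℤ.0≤i⇒+∣i∣≡i (ℤ.≤-trans (0≤+ (t ℕ.+ 2)) t+2≤W)

  2p≥4⇒p≥2 : ∀ {p} → 4 ℕ.≤ p ℕ.* 2 → 2 ℕ.≤ p
  2p≥4⇒p≥2 {p} = ℕ.*-cancelʳ-≤ 2 p 2

  p*2≡p+p : ∀ p → p ℕ.* 2 ≡ p ℕ.+ p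
  p*2≡p+p p = trans (ℕ.*-comm p 2) (cong (λ m → p ℕ.+ m) (ℕ.+-identityʳ p))

  pos-2t+5 : ∀ t → + (2 ℕ.* t ℕ.+ 5) ≡ + 2 * + t + + 5
  pos-2t+5 t = cong (λ m → m + + 5) (ℤ.pos-* 2 t)

  D≤2pw+1 : ∀ {t p w D} → 2 ℕ.≤ p → + t + + 2 ≤ + w → D ≡ + 2 * + t + + 5 → D ≤ + 2 * (+ p * + w) + 1ℤ
  D≤2pw+1 {t} {p} {w} 2≤p t+2≤w refl =
    ≤-by (0≤+0≤ (0≤+0≤ (0≤*0≤ (0≤+ 2) (0≤*0≤ (0≤- (+≤+ 2≤p)) (0≤+ w))) (0≤*0≤ (0≤+ 4) (0≤- t+2≤w))) (0≤+ (t ℕ.+ t ℕ.+ 4)))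
         (identity (+ t) (+ p) (+ w))
    where identity : ∀ t p w → + 2 * (p * w) + 1ℤ - (+ 2 * t + + 5) ≡
                       + 2 * ((p - + 2) * w) + + 4 * (w - (t + + 2)) + (t + t + + 4)
          identity = solve-∀

  modulus-identity : ∀ {L P Q Dz W d} T K G → L ≡ P * + 2 → Dz ≡ + 2 * T + + 5 → W ≡ K + G - T - + 2 →
    (P ≡ Q + Q × d ≡ Dz) ⊎ (P ≡ 1ℤ + (Q + Q) × d ≡ - Dz) →
    (+ 2 * L + + 2) * K + (L + + 3 - + 4 * (T + + 2) + G * (+ 2 * L + + 2))
      ≡ + 2 * ((1ℤ + Q * Dz + P * W) + ((1ℤ + Q * Dz + P * W) + W)) - d
  modulus-identity {Q = Q} T K G refl refl refl (inj₁ (refl , refl)) = identity T K G Q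
    where identity : ∀ T K G Q →
            (+ 2 * ((Q + Q) * + 2) + + 2) * K + ((Q + Q) * + 2 + + 3 - + 4 * (T + + 2) + G * (+ 2 * ((Q + Q) * + 2) + + 2))
            ≡ + 2 * ((1ℤ + Q * (+ 2 * T + + 5) + (Q + Q) * (K + G - T - + 2))
                     + ((1ℤ + Q * (+ 2 * T + + 5) + (Q + Q) * (K + G - T - + 2)) + (K + G - T - + 2))) - (+ 2 * T + + 5)
          identity = solve-∀
  modulus-identity {Q = Q} T K G refl refl refl (inj₂ (refl , refl)) = identity T K G Q
    where identity : ∀ T K G Q →
            (+ 2 * ((1ℤ + (Q + Q)) * + 2) + + 2) * K + ((1ℤ + (Q + Q)) * + 2 + + 3 - + 4 * (T + + 2) + G * (+ 2 * ((1ℤ + (Q + Q)) * + 2) + + 2))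
            ≡ + 2 * ((1ℤ + Q * (+ 2 * T + + 5) + (1ℤ + (Q + Q)) * (K + G - T - + 2))
                     + ((1ℤ + Q * (+ 2 * T + + 5) + (1ℤ + (Q + Q)) * (K + G - T - + 2)) + (K + G - T - + 2))) - - (+ 2 * T + + 5)
          identity = solve-∀

open import Defs
open import Data.Nat using (ℕ; _≤_)
open import Data.Nat.Divisibility using () renaming (_∣_ to _divides_)
open import Data.Integer using (ℤ; +_; _+_; _-_; _*_; ∣_∣)
import Data.Integer as ℤ
open import Data.Fin.Subset using (Subset)
open import Data.Product using (Σ-syntax; _×_)
open import Relation.Binary.PropositionalEquality using (_≡_)
open import Data.Nat.Divisibility using () renaming (divides to divides-by)
open import Data.Integer.Properties using (pos-*)
open import Data.Product using (_,_)
open import Relation.Binary.PropositionalEquality using (refl; trans)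
open Construction

theorem1p3 : (ℓ t : ℕ) → 2 divides ℓ → 4 ≤ ℓ → 1 ≤ t →
    (γ : ℤ) →
    + 1 ℤ.≤ + ℓ + + 3 - + 4 * (+ t + + 2) + γ * (+ 2 * + ℓ + + 2) →
    + ℓ + + 3 - + 4 * (+ t + + 2) + γ * (+ 2 * + ℓ + + 2) ℤ.≤ + 2 * + ℓ + + 2 →
    (k : ℕ) → 4 Data.Nat.* t Data.Nat.+ 2 Data.Nat.* ℓ Data.Nat.+ 2 Data.Nat.* ∣ γ ∣ Data.Nat.+ 2 ≤ k →
    (n : ℕ) →
    + n ≡ (+ 2 * + ℓ + + 2) * + k + (+ ℓ + + 3 - + 4 * (+ t + + 2) + γ * (+ 2 * + ℓ + + 2)) →
    Σ[ S ∈ Subset n ] (Symmetric S × CompleteSumFree ℓ S)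
theorem1p3 .(p Data.Nat.* 2) t (divides-by p refl) 4≤2p _ γ _ _ k k-large n n≡
  with shape-of (2 Data.Nat.* t Data.Nat.+ 5) p | k-large⇒width γ (2p≥4⇒p≥2 {p} 4≤2p) k-large
... | q , d , shape | w , w≡ , t+2≤w =
  construction shape (Shape⇒1≤q shape 2≤p) (D≤2pw+1 2≤p t+2≤w (pos-2t+5 t))
    (trans n≡ (modulus-identity {Q = + q} (+ t) (+ k) γ (pos-* p 2) (pos-2t+5 t) w≡ (Shape⇒parity shape)))
    (p*2≡p+p p)
  where
  open Parameters q (2 Data.Nat.* t Data.Nat.+ 5) w
  2≤p : 2 Data.Nat.≤ p
  2≤p = 2p≥4⇒p≥2 {p} 4≤2p
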